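{- Let $\Phi$ be an irreducible finite crystallographic root system with $F$-triangle $F(x,y)$, and write $F(x,-1)=\sum_k f^\natural_kx^k$. For every $k$, the number of natural cones of dimension $k$ (i.e. consisting of $k$ positive roots) equals $f^\natural_k$.
   Context: Let $\{\alpha_i\}_{i\in I}$ be the simple roots and $\Phi_{\geq -1}=\Phi_{>0}\cup\{ -\alpha_i\}_{i\in I}$. Fomin–Zelevinsky compatibility: choose $I=I_+\sqcup I_-$ with nodes in each part pairwise non-adjacent; define $\tau_\varepsilon(\alpha)=\alpha$ if $\alpha=-\alpha_i$, $i\in I_{ -\varepsilon}$, and $\tau_\varepsilon(\alpha)=(\prod_{i\in I_\varepsilon}s_i)(\alpha)$ otherwise; the compatibility degree is the unique $\mathbb{Z}_{\ge0}$-valued function with $(-\alpha_i\|\beta)=\max([\beta:\alpha_i],0)$ and $(\tau_\varepsilon\alpha\|\tau_\varepsilon\beta)=(\alpha\|\beta)$; compatible means degree $0$. Cones of the fan $\Delta(\Phi)$ are the sets of pairwise compatible almost positive roots (including $\emptyset$); the dimension of a cone is its cardinality. The $F$-triangle is $F(x,y)=\sum_{k,\ell}f_{k,\ell}x^ky^\ell$ with $f_{k,\ell}$ the number of cones with exactly $k$ positive roots and $\ell$ negative simple roots. A positive cone (one consisting only of positive roots) is natural if it is not contained in any cone containing a negative simple root, i.e. no $-\alpha_i$ is compatible with all its elements. -}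

module Defs where

open import Data.Nat as ℕ using (ℕ; zero; suc; _≡ᵇ_)
open import Data.Integer as ℤ using (ℤ; +_; _+_; _*_; -_; _-_; _≤_; _<_; _⊔_)
open import Data.Fin as Fin using (Fin)
open import Data.Vec as Vec using (Vec; []; _∷_; lookup; tabulate)
import Data.Vec.Properties as VecP
open import Data.List as List using (List; allFin; length; foldr; concatMap; _++_)
open import Data.List.Membership.Propositional using (_∈_)
open import Data.List.Relation.Unary.Unique.Propositional using (Unique)
open import Data.Bool using (Bool; true; false; if_then_else_; _∧_; not)
import Data.Bool.Properties as BoolP
open import Data.Bool.ListAction using (any; all)
open import Data.Product using (Σ; ∃; _×_; _,_)
open import Data.Sum using (_⊎_)
open import Relation.Binary.PropositionalEquality using (_≡_; _≢_)
open import Relation.Nullary.Decidable using (⌊_⌋)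

-- A Cartan matrix on the index set I = Fin n, with the Kac convention
-- A i j = ⟨α_i^∨ , α_j⟩.
CartanMatrix : ℕ → Set
CartanMatrix n = Fin n → Fin n → ℤ

sumFin : {n : ℕ} → (Fin n → ℤ) → ℤ
sumFin {n} f = foldr (λ i s → f i + s) (+ 0) (allFin n)

record IsGeneralizedCartanMatrix {n : ℕ} (A : CartanMatrix n) : Set where
  field
    diag     : ∀ i → A i i ≡ + 2
    offdiag  : ∀ i j → i ≢ j → A i j ≤ + 0
    zero-sym : ∀ i j → A i j ≡ + 0 → A j i ≡ + 0

-- Finite type: symmetrizable (d_i A_ij = d_j A_ji with d_i > 0) and the
-- symmetrized form Σ x_i d_i A_ij x_j is positive definite (tested on
-- integer vectors, equivalent to rational/real positive definiteness).
record IsFiniteType {n : ℕ} (A : CartanMatrix n) : Set where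
  field
    gcm       : IsGeneralizedCartanMatrix A
    d         : Fin n → ℕ
    d-pos     : ∀ i → 0 ℕ.< d i
    d-sym     : ∀ i j → + d i * A i j ≡ + d j * A j i
    pos-def   : (x : Fin n → ℤ) → (Σ (Fin n) λ i → x i ≢ + 0) →
                + 0 < sumFin (λ i → sumFin (λ j → x i * (+ d i * A i j) * x j))

IsIndecomposable : {n : ℕ} → CartanMatrix n → Set
IsIndecomposable {n} A =
  (S : Fin n → Bool) →
  (∀ i j → S i ≡ true → S j ≡ false → A i j ≡ + 0) →
  (∀ i → S i ≡ true) ⊎ (∀ i → S i ≡ false)

-- Roots, written in coordinates with respect to the simple roots

Vecℤ : ℕ → Set
Vecℤ n = Vec ℤ n

simpleRoot : {n : ℕ} → Fin n → Vecℤ n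
simpleRoot i = tabulate λ k → if ⌊ k Fin.≟ i ⌋ then + 1 else + 0

negSimpleRoot : {n : ℕ} → Fin n → Vecℤ n
negSimpleRoot i = tabulate λ k → if ⌊ k Fin.≟ i ⌋ then ℤ.- (+ 1) else + 0

coeff : {n : ℕ} → Vecℤ n → Fin n → ℤ
coeff β i = lookup β i

reflect : {n : ℕ} → CartanMatrix n → Fin n → Vecℤ n → Vecℤ n
reflect A i β =
  tabulate λ k → if ⌊ k Fin.≟ i ⌋
                 then lookup β k - sumFin (λ j → A i j * lookup β j)
                 else lookup β k

data IsRoot {n : ℕ} (A : CartanMatrix n) : Vecℤ n → Set where
  simple  : ∀ i → IsRoot A (simpleRoot i)
  reflected : ∀ i β → IsRoot A β → IsRoot A (reflect A i β)

IsPositiveRoot : {n : ℕ} → CartanMatrix n → Vecℤ n → Set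
IsPositiveRoot A β = IsRoot A β × (∀ k → + 0 ≤ lookup β k)

IsAlmostPositive : {n : ℕ} → CartanMatrix n → Vecℤ n → Set
IsAlmostPositive {n} A β = IsPositiveRoot A β ⊎ (Σ (Fin n) λ i → β ≡ negSimpleRoot i)

-- Bipartition I = I_+ ⊔ I_- (ε i = true means i ∈ I_+)

IsBipartition : {n : ℕ} → CartanMatrix n → (Fin n → Bool) → Set
IsBipartition A ε = ∀ i j → i ≢ j → ε i ≡ ε j → A i j ≡ + 0

_≟v_ : {n : ℕ} → (x y : Vecℤ n) → _
_≟v_ = VecP.≡-dec ℤ._≟_

-- τ_s for s ∈ {+,-} (s = true means +)
tau : {n : ℕ} → CartanMatrix n → (Fin n → Bool) → Bool → Vecℤ n → Vecℤ n
tau {n} A ε s β =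
  if any (λ i → ⌊ β ≟v negSimpleRoot i ⌋ ∧ ⌊ ε i BoolP.≟ not s ⌋) (allFin n)
  then β
  else foldr (λ i γ → if ⌊ ε i BoolP.≟ s ⌋ then reflect A i γ else γ) β (allFin n)

-- c is the Fomin–Zelevinsky compatibility degree (its defining properties
-- on Φ_{≥-1}; such a function exists and is unique).
record IsCompatibilityDegree {n : ℕ} (A : CartanMatrix n) (ε : Fin n → Bool)
                             (c : Vecℤ n → Vecℤ n → ℕ) : Set where
  field
    on-neg-simple : ∀ i β → IsAlmostPositive A β →
                    + c (negSimpleRoot i) β ≡ coeff β i ⊔ + 0
    tau-inv : ∀ s α β → IsAlmostPositive A α → IsAlmostPositive A β →
              c (tau A ε s α) (tau A ε s β) ≡ c α β

allSubsets : (m : ℕ) → List (Vec Bool m)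
allSubsets zero = [] List.∷ List.[]
allSubsets (suc m) = concatMap (λ v → (true ∷ v) List.∷ (false ∷ v) List.∷ List.[]) (allSubsets m)

select : {A : Set} {m : ℕ} → Vec A m → Vec Bool m → List A
select [] [] = List.[]
select (x ∷ xs) (true ∷ bs) = x List.∷ select xs bs
select (x ∷ xs) (false ∷ bs) = select xs bs

card : {m : ℕ} → Vec Bool m → ℕ
card [] = 0
card (true ∷ bs) = suc (card bs)
card (false ∷ bs) = card bs

countB : {A : Set} → (A → Bool) → List A → ℕ
countB p = foldr (λ x k → if p x then suc k else k) 0

pairwiseB : {A : Set} → (A → A → Bool) → List A → Bool
pairwiseB p List.[] = true
pairwiseB p (x List.∷ xs) = all (p x) xs ∧ pairwiseB p xs

-- α and β are compatible: compatibility degree 0 (checked both ways;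
-- compatibility is known to be symmetric)
compatible : {n : ℕ} → (Vecℤ n → Vecℤ n → ℕ) → Vecℤ n → Vecℤ n → Bool
compatible c α β = (c α β ≡ᵇ 0) ∧ (c β α ≡ᵇ 0)

module Cones {n : ℕ} (c : Vecℤ n → Vecℤ n → ℕ) (pos : List (Vecℤ n)) where

  m : ℕ
  m = length pos

  posV : Vec (Vecℤ n) m
  posV = Vec.fromList pos

  -- the cone with positive part S ⊆ Φ_{>0} and negative part {-α_i | i ∈ T}
  coneElems : Vec Bool m → Vec Bool n → List (Vecℤ n)
  coneElems S T = select posV S ++ select (tabulate negSimpleRoot) T

  isCone : Vec Bool m → Vec Bool n → Bool
  isCone S T = pairwiseB (compatible c) (coneElems S T)

  f : ℕ → ℕ → ℕ
  f k l = countB (λ ST → isCone (Data.Product.proj₁ ST) (Data.Product.proj₂ ST)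
                          ∧ (card (Data.Product.proj₁ ST) ≡ᵇ k)
                          ∧ (card (Data.Product.proj₂ ST) ≡ᵇ l))
                 (List.cartesianProduct (allSubsets m) (allSubsets n))

  -- f^♮_k = [x^k] F(x,-1) = Σ_ℓ (-1)^ℓ f_{k,ℓ}   (f_{k,ℓ} = 0 for ℓ > n)
  fnat : ℕ → ℤ
  fnat k = foldr (λ l s → (ℤ.- (+ 1)) ℤ.^ l * + f k l + s)
                 (+ 0) (List.upTo (suc n))

  isNatural : Vec Bool m → Bool
  isNatural S =
    pairwiseB (compatible c) (select posV S) ∧
    not (any (λ i → all (compatible c (negSimpleRoot i)) (select posV S)) (allFin n))

  numNatural : ℕ → ℕ
  numNatural k = countB (λ S → isNatural S ∧ (card S ≡ᵇ k)) (allSubsets m)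

{-# OPTIONS --safe #-}
module Submission where

-- Because the negative simple roots are pairwise compatible, a set S of positive roots
-- together with a set T of negative simple roots is a cone exactly when S is a cone and
-- every −α_i in T is compatible with all of S. Summing (−1)^|T| over the cones with
-- positive part S therefore gives Σ_{T ⊆ N(S)} (−1)^|T|, where N(S) is the set of
-- −α_i compatible with S; this alternating sum is 1 if N(S) is empty, i.e. if S is
-- natural, and 0 otherwise.

open import Defs
open import Data.Nat using (ℕ; suc; _≤_)
open import Data.Integer using (+_)
open import Data.Fin using (Fin)
open import Data.Bool using (Bool)
open import Data.List using (List)
open import Data.List.Membership.Propositional using (_∈_)
open import Data.List.Relation.Unary.Unique.Propositional using (Unique)
open import Function.Bundles using (_⇔_)
open import Relation.Binary.PropositionalEquality using (_≡_)

open import Algebra.Bundles using (CommutativeMonoid)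
import Algebra.Properties.CommutativeSemigroup as CommutativeSemigroupProperties
import Algebra.Lattice.Properties.BooleanAlgebra as BooleanAlgebraProperties
open import Data.Bool using (true; false; not; _∧_; _∨_; if_then_else_)
open import Data.Bool.ListAction using (and; or; all; any)
import Data.Bool.Properties as Bool
import Data.Fin as Fin
open import Data.Integer using (ℤ; -1ℤ; _+_; _*_; _^_; _⊔_)
import Data.Integer.Properties as ℤ
open import Data.Integer.Tactic.RingSolver using (solve-∀)
open import Data.List using ([]; _∷_; _++_; map; foldr; concatMap; cartesianProduct; tabulate; allFin; upTo)
open import Data.List.Properties using (foldr-map; foldr-cong; map-cong; map-tabulate; map-upTo)
open import Data.Nat using (zero; _<_; _≡ᵇ_; z≤n; s≤s)
open import Data.Nat.Properties using (m≤n⇒m≤1+n)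
open import Data.Product using (_×_; _,_; proj₁; proj₂)
open import Data.Sum using (inj₂)
open import Data.Vec as Vec using (Vec)
open import Data.Vec.Properties using (lookup∘tabulate)
open import Function using (_∘_)
open import Relation.Binary.PropositionalEquality using (refl; sym; trans; cong; cong₂; module ≡-Reasoning)
open import Relation.Nullary.Decidable using (⌊_⌋)

open ≡-Reasoning

-- A foldr rather than a recursive definition, so that fnat k is by definition
-- ∑ (λ l → -1ℤ ^ l * + f k l) (upTo (suc n)).
∑ : {X : Set} → (X → ℤ) → List X → ℤ
∑ g = foldr (λ x s → g x + s) (+ 0)

∑-cong : {X : Set} {g h : X → ℤ} → (∀ x → g x ≡ h x) → ∀ xs → ∑ g xs ≡ ∑ h xs
∑-cong g≗h []       = refl
∑-cong g≗h (x ∷ xs) = cong₂ _+_ (g≗h x) (∑-cong g≗h xs)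

∑-zero : {X : Set} (xs : List X) → ∑ (λ _ → + 0) xs ≡ + 0
∑-zero []       = refl
∑-zero (x ∷ xs) = trans (ℤ.+-identityˡ _) (∑-zero xs)

∑-++ : {X : Set} (g : X → ℤ) (xs ys : List X) → ∑ g (xs ++ ys) ≡ ∑ g xs + ∑ g ys
∑-++ g []       ys = sym (ℤ.+-identityˡ _)
∑-++ g (x ∷ xs) ys = trans (cong (_+_ (g x)) (∑-++ g xs ys)) (sym (ℤ.+-assoc (g x) _ _))

∑-map : {X Y : Set} (g : Y → ℤ) (h : X → Y) (xs : List X) → ∑ g (map h xs) ≡ ∑ (g ∘ h) xs
∑-map g h = foldr-map _ h (+ 0)

∑-concatMap : {X Y : Set} (g : Y → ℤ) (h : X → List Y) (xs : List X) →
              ∑ g (concatMap h xs) ≡ ∑ (λ x → ∑ g (h x)) xs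
∑-concatMap g h []       = refl
∑-concatMap g h (x ∷ xs) = trans (∑-++ g (h x) (concatMap h xs)) (cong (_+_ (∑ g (h x))) (∑-concatMap g h xs))

∑-cartesianProduct : {X Y : Set} (g : _ → ℤ) (xs : List X) (ys : List Y) →
                     ∑ g (cartesianProduct xs ys) ≡ ∑ (λ x → ∑ (λ y → g (x , y)) ys) xs
∑-cartesianProduct g []       ys = refl
∑-cartesianProduct g (x ∷ xs) ys =
  trans (∑-++ g (map (x ,_) ys) (cartesianProduct xs ys))
        (cong₂ _+_ (∑-map g (x ,_) ys) (∑-cartesianProduct g xs ys))

*-distribˡ-∑ : {X : Set} (a : ℤ) (g : X → ℤ) (xs : List X) → a * ∑ g xs ≡ ∑ (λ x → a * g x) xs
*-distribˡ-∑ a g []       = ℤ.*-zeroʳ a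
*-distribˡ-∑ a g (x ∷ xs) = trans (ℤ.*-distribˡ-+ a (g x) _) (cong (_+_ (a * g x)) (*-distribˡ-∑ a g xs))

∑-distrib-+ : {X : Set} (g h : X → ℤ) (xs : List X) → ∑ (λ x → g x + h x) xs ≡ ∑ g xs + ∑ h xs
∑-distrib-+ g h []       = refl
∑-distrib-+ g h (x ∷ xs) =
  trans (cong (_+_ (g x + h x)) (∑-distrib-+ g h xs)) (+-interchange (g x) (h x) _ _)
  where open CommutativeSemigroupProperties ℤ.+-commutativeSemigroup renaming (interchange to +-interchange)

∑-comm : {X Y : Set} (g : Y → X → ℤ) (xs : List X) (ys : List Y) →
         ∑ (λ y → ∑ (g y) xs) ys ≡ ∑ (λ x → ∑ (λ y → g y x) ys) xs
∑-comm g xs []       = sym (∑-zero xs)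
∑-comm g xs (y ∷ ys) = trans (cong (_+_ (∑ (g y) xs)) (∑-comm g xs ys)) (sym (∑-distrib-+ (g y) _ xs))

∑-upTo-suc : (g : ℕ → ℤ) (N : ℕ) → ∑ g (upTo (suc N)) ≡ g 0 + ∑ (g ∘ suc) (upTo N)
∑-upTo-suc g N = cong (_+_ (g 0)) (trans (cong (∑ g) (sym (map-upTo suc N))) (∑-map g suc (upTo N)))

𝟙 : Bool → ℤ
𝟙 true  = + 1
𝟙 false = + 0

𝟙-∧ : ∀ a b → 𝟙 (a ∧ b) ≡ 𝟙 a * 𝟙 b
𝟙-∧ true  b = sym (ℤ.*-identityˡ (𝟙 b))
𝟙-∧ false b = refl

𝟙-not-∨ : ∀ a b → 𝟙 (not (a ∨ b)) ≡ 𝟙 (not a) * 𝟙 (not b)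
𝟙-not-∨ a b = trans (cong 𝟙 (deMorgan₂ a b)) (𝟙-∧ (not a) (not b))
  where open BooleanAlgebraProperties Bool.∨-∧-booleanAlgebra using (deMorgan₂)

∑-δ : {N j : ℕ} (a : ℕ → ℤ) → j < N → ∑ (λ l → a l * 𝟙 (j ≡ᵇ l)) (upTo N) ≡ a j
∑-δ {suc N} {zero} a _ = begin
  ∑ (λ l → a l * 𝟙 (0 ≡ᵇ l)) (upTo (suc N))
    ≡⟨ ∑-upTo-suc (λ l → a l * 𝟙 (0 ≡ᵇ l)) N ⟩
  a 0 * + 1 + ∑ (λ l → a (suc l) * + 0) (upTo N)
    ≡⟨ cong₂ _+_ (ℤ.*-identityʳ (a 0)) (∑-cong (ℤ.*-zeroʳ ∘ a ∘ suc) (upTo N)) ⟩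
  a 0 + ∑ (λ _ → + 0) (upTo N)
    ≡⟨ cong (_+_ (a 0)) (∑-zero (upTo N)) ⟩
  a 0 + + 0
    ≡⟨ ℤ.+-identityʳ (a 0) ⟩
  a 0
    ∎
∑-δ {suc N} {suc j} a (s≤s j<N) = begin
  ∑ (λ l → a l * 𝟙 (suc j ≡ᵇ l)) (upTo (suc N)) ≡⟨ ∑-upTo-suc (λ l → a l * 𝟙 (suc j ≡ᵇ l)) N ⟩
  a 0 * + 0 + rest                               ≡⟨ cong (_+ rest) (ℤ.*-zeroʳ (a 0)) ⟩
  + 0 + rest                                     ≡⟨ ℤ.+-identityˡ rest ⟩
  rest                                           ≡⟨ ∑-δ (a ∘ suc) j<N ⟩
  a (suc j)                                      ∎
  where rest = ∑ (λ l → a (suc l) * 𝟙 (j ≡ᵇ l)) (upTo N)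

countB-cong : {X : Set} {p q : X → Bool} → (∀ x → p x ≡ q x) → ∀ xs → countB p xs ≡ countB q xs
countB-cong p≗q = foldr-cong (λ x k → cong (if_then suc k else k) (p≗q x)) refl

countB-∑ : {X : Set} (p : X → Bool) (xs : List X) → + countB p xs ≡ ∑ (𝟙 ∘ p) xs
countB-∑ p []       = refl
countB-∑ p (x ∷ xs) with p x
... | true  = cong (_+_ (+ 1)) (countB-∑ p xs)
... | false = trans (countB-∑ p xs) (sym (ℤ.+-identityˡ _))

∑-countB-fibres : {X : Set} {N : ℕ} (p : X → Bool) (w : X → ℕ) (a : ℕ → ℤ) → (∀ x → w x < N) →
                  (xs : List X) →
                  ∑ (λ l → a l * + countB (λ x → p x ∧ (w x ≡ᵇ l)) xs) (upTo N)
                  ≡ ∑ (λ x → 𝟙 (p x) * a (w x)) xs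
∑-countB-fibres {N = N} p w a w<N xs = begin
  ∑ (λ l → a l * + countB (λ x → p x ∧ (w x ≡ᵇ l)) xs) (upTo N)
    ≡⟨ ∑-cong (λ l → trans (cong (a l *_) (countB-∑ _ xs)) (*-distribˡ-∑ (a l) _ xs)) (upTo N) ⟩
  ∑ (λ l → ∑ (λ x → a l * 𝟙 (p x ∧ (w x ≡ᵇ l))) xs) (upTo N)
    ≡⟨ ∑-comm (λ l x → a l * 𝟙 (p x ∧ (w x ≡ᵇ l))) xs (upTo N) ⟩
  ∑ (λ x → ∑ (λ l → a l * 𝟙 (p x ∧ (w x ≡ᵇ l))) (upTo N)) xs
    ≡⟨ ∑-cong fibre xs ⟩
  ∑ (λ x → 𝟙 (p x) * a (w x)) xs
    ∎
  where
  open CommutativeSemigroupProperties ℤ.*-commutativeSemigroup using (x∙yz≈y∙xz)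
  fibre : ∀ x → ∑ (λ l → a l * 𝟙 (p x ∧ (w x ≡ᵇ l))) (upTo N) ≡ 𝟙 (p x) * a (w x)
  fibre x = begin
    ∑ (λ l → a l * 𝟙 (p x ∧ (w x ≡ᵇ l))) (upTo N)
      ≡⟨ ∑-cong (λ l → trans (cong (a l *_) (𝟙-∧ (p x) _)) (x∙yz≈y∙xz (a l) (𝟙 (p x)) (𝟙 (w x ≡ᵇ l))))
                (upTo N) ⟩
    ∑ (λ l → 𝟙 (p x) * (a l * 𝟙 (w x ≡ᵇ l))) (upTo N)
      ≡⟨ sym (*-distribˡ-∑ (𝟙 (p x)) _ (upTo N)) ⟩
    𝟙 (p x) * ∑ (λ l → a l * 𝟙 (w x ≡ᵇ l)) (upTo N)
      ≡⟨ cong (𝟙 (p x) *_) (∑-δ a (w<N x)) ⟩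
    𝟙 (p x) * a (w x)
      ∎

open CommutativeSemigroupProperties (CommutativeMonoid.commutativeSemigroup Bool.∧-commutativeMonoid)
  using () renaming (interchange to ∧-interchange)

all-cong : {X : Set} {q r : X → Bool} → (∀ x → q x ≡ r x) → ∀ xs → all q xs ≡ all r xs
all-cong q≗r xs = cong and (map-cong q≗r xs)

all-true : {X : Set} (xs : List X) → all (λ _ → true) xs ≡ true
all-true []       = refl
all-true (x ∷ xs) = all-true xs

all-++ : {X : Set} (q : X → Bool) (xs ys : List X) → all q (xs ++ ys) ≡ all q xs ∧ all q ys
all-++ q []       ys = refl
all-++ q (x ∷ xs) ys = trans (cong (q x ∧_) (all-++ q xs ys)) (sym (Bool.∧-assoc (q x) _ _))

all-∧ : {X : Set} (q r : X → Bool) (xs : List X) → all (λ x → q x ∧ r x) xs ≡ all q xs ∧ all r xs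
all-∧ q r []       = refl
all-∧ q r (x ∷ xs) = trans (cong ((q x ∧ r x) ∧_) (all-∧ q r xs)) (∧-interchange (q x) (r x) _ _)

all-comm : {X Y : Set} (r : X → Y → Bool) (xs : List X) (ys : List Y) →
           all (λ x → all (r x) ys) xs ≡ all (λ y → all (λ x → r x y) xs) ys
all-comm r []       ys = sym (all-true ys)
all-comm r (x ∷ xs) ys =
  trans (cong (all (r x) ys ∧_) (all-comm r xs ys)) (sym (all-∧ (r x) (λ y → all (λ x′ → r x′ y) xs) ys))

pairwiseB-++ : {X : Set} (p : X → X → Bool) (xs ys : List X) →
               pairwiseB p (xs ++ ys) ≡ pairwiseB p xs ∧ all (λ x → all (p x) ys) xs ∧ pairwiseB p ys
pairwiseB-++ p []       ys = refl
pairwiseB-++ p (x ∷ xs) ys = begin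
  all (p x) (xs ++ ys) ∧ pairwiseB p (xs ++ ys)
    ≡⟨ cong₂ _∧_ (all-++ (p x) xs ys) (pairwiseB-++ p xs ys) ⟩
  (all (p x) xs ∧ all (p x) ys) ∧ (pairwiseB p xs ∧ cross ∧ pairwiseB p ys)
    ≡⟨ ∧-interchange (all (p x) xs) (all (p x) ys) (pairwiseB p xs) (cross ∧ pairwiseB p ys) ⟩
  (all (p x) xs ∧ pairwiseB p xs) ∧ (all (p x) ys ∧ cross ∧ pairwiseB p ys)
    ≡⟨ cong (pairwiseB p (x ∷ xs) ∧_) (sym (Bool.∧-assoc (all (p x) ys) cross (pairwiseB p ys))) ⟩
  (all (p x) xs ∧ pairwiseB p xs) ∧ (all (p x) ys ∧ cross) ∧ pairwiseB p ys
    ∎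
  where cross = all (λ x′ → all (p x′) ys) xs

all-select-tabulate : {X : Set} {n : ℕ} (q : X → Bool) (f : Fin n → X) → (∀ i → q (f i) ≡ true) →
                      (T : Vec Bool n) → all q (select (Vec.tabulate f) T) ≡ true
all-select-tabulate q f qf Vec.[]          = refl
all-select-tabulate q f qf (true Vec.∷ T)  =
  cong₂ _∧_ (qf Fin.zero) (all-select-tabulate q (f ∘ Fin.suc) (qf ∘ Fin.suc) T)
all-select-tabulate q f qf (false Vec.∷ T) = all-select-tabulate q (f ∘ Fin.suc) (qf ∘ Fin.suc) T

pairwiseB-select-tabulate : {X : Set} {n : ℕ} (p : X → X → Bool) (f : Fin n → X) →
                            (∀ i j → p (f i) (f j) ≡ true) →
                            (T : Vec Bool n) → pairwiseB p (select (Vec.tabulate f) T) ≡ true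
pairwiseB-select-tabulate p f pf Vec.[] = refl
pairwiseB-select-tabulate p f pf (true Vec.∷ T) =
  cong₂ _∧_ (all-select-tabulate (p (f Fin.zero)) (f ∘ Fin.suc) (pf Fin.zero ∘ Fin.suc) T)
            (pairwiseB-select-tabulate p (f ∘ Fin.suc) (λ i j → pf (Fin.suc i) (Fin.suc j)) T)
pairwiseB-select-tabulate p f pf (false Vec.∷ T) =
  pairwiseB-select-tabulate p (f ∘ Fin.suc) (λ i j → pf (Fin.suc i) (Fin.suc j)) T

any-tabulate : {X : Set} {n : ℕ} (q : X → Bool) (f : Fin n → X) → any (q ∘ f) (allFin n) ≡ any q (tabulate f)
any-tabulate q f = cong or (trans (map-tabulate _ (q ∘ f)) (sym (map-tabulate f q)))

card≤ : {m : ℕ} (S : Vec Bool m) → card S ≤ m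
card≤ Vec.[]          = z≤n
card≤ (true Vec.∷ S)  = s≤s (card≤ S)
card≤ (false Vec.∷ S) = m≤n⇒m≤1+n (card≤ S)

∑-alternating-subsets : {X : Set} {n : ℕ} (q : X → Bool) (f : Fin n → X) →
  ∑ (λ T → 𝟙 (all q (select (Vec.tabulate f) T)) * -1ℤ ^ card T) (allSubsets n) ≡ 𝟙 (not (any q (tabulate f)))
∑-alternating-subsets {n = zero}  q f = refl
∑-alternating-subsets {n = suc n} q f = begin
  ∑ term (allSubsets (suc n))
    ≡⟨ ∑-concatMap term (λ T → (true Vec.∷ T) ∷ (false Vec.∷ T) ∷ []) (allSubsets n) ⟩
  ∑ (λ T → term (true Vec.∷ T) + (term (false Vec.∷ T) + + 0)) (allSubsets n)
    ≡⟨ ∑-cong (λ T → extend (q (f Fin.zero)) (all q (select (Vec.tabulate (f ∘ Fin.suc)) T)) (-1ℤ ^ card T))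
              (allSubsets n) ⟩
  ∑ (λ T → 𝟙 (not (q (f Fin.zero))) * term′ T) (allSubsets n)
    ≡⟨ sym (*-distribˡ-∑ (𝟙 (not (q (f Fin.zero)))) term′ (allSubsets n)) ⟩
  𝟙 (not (q (f Fin.zero))) * ∑ term′ (allSubsets n)
    ≡⟨ cong (_*_ (𝟙 (not (q (f Fin.zero))))) (∑-alternating-subsets q (f ∘ Fin.suc)) ⟩
  𝟙 (not (q (f Fin.zero))) * 𝟙 (not (any q (tabulate (f ∘ Fin.suc))))
    ≡⟨ sym (𝟙-not-∨ (q (f Fin.zero)) _) ⟩
  𝟙 (not (any q (tabulate f)))
    ∎
  where
  term : Vec Bool (suc n) → ℤ
  term T = 𝟙 (all q (select (Vec.tabulate f) T)) * -1ℤ ^ card T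
  term′ : Vec Bool n → ℤ
  term′ T = 𝟙 (all q (select (Vec.tabulate (f ∘ Fin.suc)) T)) * -1ℤ ^ card T
  cancel : ∀ x s → x * (-1ℤ * s) + (x * s + + 0) ≡ + 0 * (x * s)
  cancel = solve-∀
  keep : ∀ x s → + 0 * (-1ℤ * s) + (x * s + + 0) ≡ + 1 * (x * s)
  keep = solve-∀
  -- The terms of T ∪ {0} and T cancel unless q fails at f 0, which excludes T ∪ {0}.
  extend : ∀ b a s → 𝟙 (b ∧ a) * (-1ℤ * s) + (𝟙 a * s + + 0) ≡ 𝟙 (not b) * (𝟙 a * s)
  extend true  a = cancel (𝟙 a)
  extend false a = keep (𝟙 a)

module NaturalCones {n : ℕ} (c : Vecℤ n → Vecℤ n → ℕ) (pos : List (Vecℤ n))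
  (negSimpleRoots-compatible : ∀ i j → compatible c (negSimpleRoot i) (negSimpleRoot j) ≡ true) where

  open Cones c pos

  pairwiseCompatible : List (Vecℤ n) → Bool
  pairwiseCompatible = pairwiseB (compatible c)

  positives : Vec Bool m → List (Vecℤ n)
  positives S = select posV S

  negatives : Vec Bool n → List (Vecℤ n)
  negatives T = select (Vec.tabulate negSimpleRoot) T

  compatibleWith : Vec Bool m → Vecℤ n → Bool
  compatibleWith S β = all (compatible c β) (positives S)

  compatible-sym : ∀ α β → compatible c α β ≡ compatible c β α
  compatible-sym α β = Bool.∧-comm (c α β ≡ᵇ 0) (c β α ≡ᵇ 0)

  isCone-split : ∀ S T → isCone S T ≡ pairwiseCompatible (positives S) ∧ all (compatibleWith S) (negatives T)
  isCone-split S T = begin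
    pairwiseCompatible (positives S ++ negatives T)
      ≡⟨ pairwiseB-++ (compatible c) (positives S) (negatives T) ⟩
    pairwiseCompatible P ∧ all (λ α → all (compatible c α) N) P ∧ pairwiseCompatible N
      ≡⟨ cong₂ (λ x y → pairwiseCompatible P ∧ x ∧ y) cross
               (pairwiseB-select-tabulate (compatible c) negSimpleRoot negSimpleRoots-compatible T) ⟩
    pairwiseCompatible P ∧ all (compatibleWith S) N ∧ true
      ≡⟨ cong (pairwiseCompatible P ∧_) (Bool.∧-identityʳ _) ⟩
    pairwiseCompatible P ∧ all (compatibleWith S) N
      ∎
    where
    P = positives S
    N = negatives T
    cross : all (λ α → all (compatible c α) N) P ≡ all (compatibleWith S) N
    cross = trans (all-comm (compatible c) P N) (all-cong (λ β → all-cong (λ α → compatible-sym α β) P) N)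

  ∑-alternating-cones : ∀ S → ∑ (λ T → 𝟙 (isCone S T) * -1ℤ ^ card T) (allSubsets n) ≡ 𝟙 (isNatural S)
  ∑-alternating-cones S = begin
    ∑ (λ T → 𝟙 (isCone S T) * -1ℤ ^ card T) (allSubsets n)
      ≡⟨ ∑-cong split (allSubsets n) ⟩
    ∑ (λ T → 𝟙 (pairwiseCompatible P) * extension T) (allSubsets n)
      ≡⟨ sym (*-distribˡ-∑ (𝟙 (pairwiseCompatible P)) extension (allSubsets n)) ⟩
    𝟙 (pairwiseCompatible P) * ∑ extension (allSubsets n)
      ≡⟨ cong (_*_ (𝟙 (pairwiseCompatible P))) (∑-alternating-subsets (compatibleWith S) negSimpleRoot) ⟩
    𝟙 (pairwiseCompatible P) * 𝟙 (not (any (compatibleWith S) (tabulate negSimpleRoot)))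
      ≡⟨ sym (𝟙-∧ (pairwiseCompatible P) _) ⟩
    𝟙 (pairwiseCompatible P ∧ not (any (compatibleWith S) (tabulate negSimpleRoot)))
      ≡⟨ cong (λ b → 𝟙 (pairwiseCompatible P ∧ not b)) (sym (any-tabulate (compatibleWith S) negSimpleRoot)) ⟩
    𝟙 (isNatural S)
      ∎
    where
    P = positives S
    extension : Vec Bool n → ℤ
    extension T = 𝟙 (all (compatibleWith S) (negatives T)) * -1ℤ ^ card T
    split : ∀ T → 𝟙 (isCone S T) * -1ℤ ^ card T ≡ 𝟙 (pairwiseCompatible P) * extension T
    split T = begin
      𝟙 (isCone S T) * -1ℤ ^ card T
        ≡⟨ cong (λ b → 𝟙 b * -1ℤ ^ card T) (isCone-split S T) ⟩
      𝟙 (pairwiseCompatible P ∧ all (compatibleWith S) (negatives T)) * -1ℤ ^ card T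
        ≡⟨ cong (_* -1ℤ ^ card T) (𝟙-∧ (pairwiseCompatible P) _) ⟩
      𝟙 (pairwiseCompatible P) * 𝟙 (all (compatibleWith S) (negatives T)) * -1ℤ ^ card T
        ≡⟨ ℤ.*-assoc (𝟙 (pairwiseCompatible P)) _ _ ⟩
      𝟙 (pairwiseCompatible P) * extension T
        ∎

  numNatural≡fnat : ∀ k → + numNatural k ≡ fnat k
  numNatural≡fnat k = sym (begin
    ∑ (λ l → -1ℤ ^ l * + f k l) (upTo (suc n))
      ≡⟨ ∑-cong (λ l → cong (λ x → -1ℤ ^ l * + x) (countB-cong reassociate pairs)) (upTo (suc n)) ⟩
    ∑ (λ l → -1ℤ ^ l * + countB (λ ST → coneOfDim ST ∧ (card (proj₂ ST) ≡ᵇ l)) pairs) (upTo (suc n))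
      ≡⟨ ∑-countB-fibres coneOfDim (card ∘ proj₂) (-1ℤ ^_) (λ ST → s≤s (card≤ (proj₂ ST))) pairs ⟩
    ∑ (λ ST → 𝟙 (coneOfDim ST) * -1ℤ ^ card (proj₂ ST)) pairs
      ≡⟨ ∑-cartesianProduct (λ ST → 𝟙 (coneOfDim ST) * -1ℤ ^ card (proj₂ ST)) (allSubsets m) (allSubsets n) ⟩
    ∑ (λ S → ∑ (λ T → 𝟙 (isCone S T ∧ (card S ≡ᵇ k)) * -1ℤ ^ card T) (allSubsets n)) (allSubsets m)
      ≡⟨ ∑-cong positivePart (allSubsets m) ⟩
    ∑ (λ S → 𝟙 (isNatural S ∧ (card S ≡ᵇ k))) (allSubsets m)
      ≡⟨ sym (countB-∑ (λ S → isNatural S ∧ (card S ≡ᵇ k)) (allSubsets m)) ⟩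
    + numNatural k
      ∎)
    where
    open CommutativeSemigroupProperties ℤ.*-commutativeSemigroup using (xy∙z≈y∙xz)
    pairs = cartesianProduct (allSubsets m) (allSubsets n)
    coneOfDim : Vec Bool m × Vec Bool n → Bool
    coneOfDim ST = isCone (proj₁ ST) (proj₂ ST) ∧ (card (proj₁ ST) ≡ᵇ k)
    reassociate : ∀ {l} ST → isCone (proj₁ ST) (proj₂ ST) ∧ (card (proj₁ ST) ≡ᵇ k) ∧ (card (proj₂ ST) ≡ᵇ l)
                             ≡ coneOfDim ST ∧ (card (proj₂ ST) ≡ᵇ l)
    reassociate ST = sym (Bool.∧-assoc (isCone (proj₁ ST) (proj₂ ST)) _ _)
    positivePart : ∀ S → ∑ (λ T → 𝟙 (isCone S T ∧ (card S ≡ᵇ k)) * -1ℤ ^ card T) (allSubsets n)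
                         ≡ 𝟙 (isNatural S ∧ (card S ≡ᵇ k))
    positivePart S = begin
      ∑ (λ T → 𝟙 (isCone S T ∧ dim) * -1ℤ ^ card T) (allSubsets n)
        ≡⟨ ∑-cong (λ T → trans (cong (_* -1ℤ ^ card T) (𝟙-∧ (isCone S T) dim))
                               (xy∙z≈y∙xz (𝟙 (isCone S T)) (𝟙 dim) (-1ℤ ^ card T))) (allSubsets n) ⟩
      ∑ (λ T → 𝟙 dim * (𝟙 (isCone S T) * -1ℤ ^ card T)) (allSubsets n)
        ≡⟨ sym (*-distribˡ-∑ (𝟙 dim) (λ T → 𝟙 (isCone S T) * -1ℤ ^ card T) (allSubsets n)) ⟩
      𝟙 dim * ∑ (λ T → 𝟙 (isCone S T) * -1ℤ ^ card T) (allSubsets n)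
        ≡⟨ cong (_*_ (𝟙 dim)) (∑-alternating-cones S) ⟩
      𝟙 dim * 𝟙 (isNatural S)
        ≡⟨ ℤ.*-comm (𝟙 dim) _ ⟩
      𝟙 (isNatural S) * 𝟙 dim
        ≡⟨ sym (𝟙-∧ (isNatural S) dim) ⟩
      𝟙 (isNatural S ∧ dim)
        ∎
      where dim = card S ≡ᵇ k

negSimpleRoots-compatible : {n : ℕ} {A : CartanMatrix n} {ε : Fin n → Bool} {c : Vecℤ n → Vecℤ n → ℕ} →
                            IsCompatibilityDegree A ε c →
                            ∀ i j → compatible c (negSimpleRoot i) (negSimpleRoot j) ≡ true
negSimpleRoots-compatible {c = c} cd i j =
  cong₂ (λ x y → (x ≡ᵇ 0) ∧ (y ≡ᵇ 0)) (degree-zero i j) (degree-zero j i)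
  where
  clip : (b : Bool) → (if b then -1ℤ else + 0) ⊔ + 0 ≡ + 0
  clip true  = refl
  clip false = refl
  degree-zero : ∀ i j → c (negSimpleRoot i) (negSimpleRoot j) ≡ 0
  degree-zero i j = ℤ.+-injective (begin
    + c (negSimpleRoot i) (negSimpleRoot j)
      ≡⟨ IsCompatibilityDegree.on-neg-simple cd i _ (inj₂ (j , refl)) ⟩
    coeff (negSimpleRoot j) i ⊔ + 0
      ≡⟨ cong (_⊔ + 0) (lookup∘tabulate _ i) ⟩
    (if ⌊ i Fin.≟ j ⌋ then -1ℤ else + 0) ⊔ + 0
      ≡⟨ clip ⌊ i Fin.≟ j ⌋ ⟩
    + 0
      ∎)

proposition8 : (n : ℕ) → 1 ≤ n → (A : CartanMatrix n) → IsFiniteType A → IsIndecomposable A →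
    (ε : Fin n → Bool) → IsBipartition A ε →
    (c : Vecℤ n → Vecℤ n → ℕ) → IsCompatibilityDegree A ε c →
    (pos : List (Vecℤ n)) → Unique pos → (∀ β → (β ∈ pos) ⇔ IsPositiveRoot A β) →
    (k : ℕ) → + Cones.numNatural c pos k ≡ Cones.fnat c pos k
proposition8 _ _ _ _ _ _ _ c cd pos _ _ = NaturalCones.numNatural≡fnat c pos (negSimpleRoots-compatible cd)
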